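{- For every cirquent $C$ and every interpretation $^*$, the game $C^*$ is static.
   Context: Games. A move is a finite string over a fixed finite alphabet; a labmove is a move prefixed by a player label $\top$ or $\bot$; a run is a finite or infinite sequence of labmoves. For a player $\wp$, $\overline{\wp}$ is the other player; $\overline{\Gamma}$ is $\Gamma$ with labels $\top,\bot$ interchanged. A game is a pair $G=(\mathbf{Lr}^G,\mathbf{Wn}^G)$ with $\mathbf{Lr}^G$ a nonempty, initial-segment-closed and limit-closed set of runs (the legal runs) and $\mathbf{Wn}^G:\mathbf{Lr}^G\to\{\top,\bot\}$. A run $\Gamma$ is $\wp$-legal if it is legal or the last labmove of its shortest illegal initial segment is $\overline{\wp}$-labeled; $\Gamma$ is $\wp$-won if it is legal with $\mathbf{Wn}^G\langle\Gamma\rangle=\wp$, or it is not $\overline{\wp}$-legal. $\Upsilon$ is a $\wp$-delay of $\Gamma$ if for each player the subsequence of that player's labmoves is the same in $\Upsilon$ and $\Gamma$, and whenever in $\Gamma$ the $n$th $\wp$-labeled move is to the right of the $k$th $\overline{\wp}$-labeled move, the same holds in $\Upsilon$. $G$ is static if, for both $\wp$ and every $\wp$-delay $\Upsilon$ of any run $\Gamma$: if $\Gamma$ is $\wp$-legal then so is $\Upsilon$, and if $\Gamma$ is $\wp$-won then so is $\Upsilon$. The negation $\neg G$: $\mathbf{Lr}^{\neg G}=\{\overline{\Gamma}:\Gamma\in\mathbf{Lr}^G\}$, $\mathbf{Wn}^{\neg G}\langle\Gamma\rangle=\top$ iff $\mathbf{Wn}^G\langle\overline{\Gamma}\rangle=\bot$.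 Cirquents. Letters $P,Q,\dots$; clusters are natural numbers. Literals: $P^a$, $\neg P^a$. Cirquents: $\top$, $\bot$, literals, and $A\vee B$, $A\wedge B$, $A\sqcap^c B$, $A\sqcup^c B$ for cirquents $A,B$ and cluster $c$. Semantics. An interpretation $^*$ assigns a static game $P^*$ to every letter; $(P^a)^*=P^*$, $(\neg P^a)^*=\neg(P^*)$. For a run $\Gamma$ and literal $L$, $\Gamma^{L.}$ keeps only the labmoves of the form $\wp L.\alpha$ and replaces each by $\wp\alpha$. The game $C^*$: a run $\Gamma$ is legal iff every labmove is of the form $\wp L.\alpha$ ($L$ a literal) or a choice labmove $\bot\sqcap^c.i$ or $\top\sqcup^c.i$ ($i\in\{0,1\}$), for every literal $L$ the run $\Gamma^{L.}$ is legal in $L^*$, and for every cluster $c$ there is at most one labmove of the form $\bot\sqcap^c.i$ and at most one of the form $\top\sqcup^c.i$. If $\bot\sqcap^c.i$ (resp. $\top\sqcup^c.i$) occurs in $\Gamma$, each subcirquent $A_0\sqcap^c A_1$ (resp. $A_0\sqcup^c A_1$) is resolved with resolvent $A_i$; otherwise unresolved. A legal $\Gamma$ is won by $\top$ in $C^*$ iff: $C=\top$; or $C$ is a literal $L$ and $\mathbf{Wn}^{L^*}\langle\Gamma^{L.}\rangle=\top$; or $C=A_0\wedge A_1$ (resp. $A_0\vee A_1$) and $\Gamma$ is $\top$-won in both (resp. at least one) $A_i^*$; or $C$ is a resolved $\sqcap^c$- or $\sqcup^c$-rooted cirquent and $\Gamma$ is $\top$-won in the resolvent under $^*$; or $C$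 is an unresolved $\sqcap^c$-rooted cirquent. Otherwise it is won by $\bot$. -}

module Defs where

open import Data.Nat using (ℕ; zero; suc; _+_; _<_; _<ᵇ_; _≟_)
open import Data.Maybe using (Maybe; just; nothing)
open import Data.Product using (Σ; _×_; _,_)
open import Data.Sum using (_⊎_)
open import Data.Empty using (⊥)
open import Data.Unit using (⊤)
open import Data.Bool using (Bool; true; false; if_then_else_; _∧_)
open import Data.List using (List)
open import Data.Fin using (Fin; zero; suc)
open import Relation.Nullary using (¬_; yes; no)
open import Relation.Binary.PropositionalEquality using (_≡_)

data Player : Set where
  top bot : Player

opp : Player → Player
opp top = bot
opp bot = top

_==ᴾ_ : Player → Player → Bool
top ==ᴾ top = true
bot ==ᴾ bot = true
_   ==ᴾ _   = false

Letter : Set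
Letter = ℕ

Cluster : Set
Cluster = ℕ

data Lit : Set where
  pos : Letter → Cluster → Lit
  neg : Letter → Cluster → Lit

_==ᴸ_ : Lit → Lit → Bool
pos P a ==ᴸ pos Q b with P ≟ Q | a ≟ b
... | yes _ | yes _ = true
... | _     | _     = false
neg P a ==ᴸ neg Q b with P ≟ Q | a ≟ b
... | yes _ | yes _ = true
... | _     | _     = false
_ ==ᴸ _ = false

-- Moves (strings), given by their unique parse:
--   litMv L α  is the string  "L.α",
--   ⊓mv c i    is the string  "⊓^c.i",  ⊔mv c i  is  "⊔^c.i",
--   atom w     is any other string (w over a binary alphabet).
data Move : Set where
  atom  : List Bool → Move
  litMv : Lit → Move → Move
  ⊓mv   : Cluster → Fin 2 → Move
  ⊔mv   : Cluster → Fin 2 → Move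

Labmove : Set
Labmove = Player × Move

-- A run is presented as a sequence of steps, each step either a labmove
-- or empty (nothing).  The run it denotes is the subsequence of labmoves;
-- finite runs are those with finitely many labmoves.  Runs denoting the
-- same sequence are identified via _≈_ below (games must respect it).
Run : Set
Run = ℕ → Maybe Labmove

emptyRun : Run
emptyRun _ = nothing

isMove : Maybe Labmove → ℕ
isMove nothing  = 0
isMove (just _) = 1

countMoves : Run → ℕ → ℕ
countMoves Γ zero    = 0
countMoves Γ (suc i) = countMoves Γ i + isMove (Γ i)

-- the n-th (0-based) labmove of Γ is x
NthMove : Run → ℕ → Labmove → Set
NthMove Γ n x = Σ ℕ λ i → (Γ i ≡ just x) × (countMoves Γ i ≡ n)

_≈_ : Run → Run → Set
Γ ≈ Δ = ∀ n x → (NthMove Γ n x → NthMove Δ n x) × (NthMove Δ n x → NthMove Γ n x)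

restrict : Run → ℕ → Run
restrict Γ n i = if i <ᵇ n then Γ i else nothing

flipLab : Maybe Labmove → Maybe Labmove
flipLab nothing        = nothing
flipLab (just (p , m)) = just (opp p , m)

flipR : Run → Run
flipR Γ i = flipLab (Γ i)

keepP : Player → Maybe Labmove → Maybe Labmove
keepP ℘ nothing        = nothing
keepP ℘ (just (p , m)) = if p ==ᴾ ℘ then just (p , m) else nothing

onlyP : Player → Run → Run
onlyP ℘ Γ i = keepP ℘ (Γ i)

-- the n-th (0-based) ℘-labeled labmove of Γ is at step i
PosNth : Player → Run → ℕ → ℕ → Set
PosNth ℘ Γ n i = Σ Move λ m → (Γ i ≡ just (℘ , m)) × (countMoves (onlyP ℘ Γ) i ≡ n)

-- Υ is a ℘-delay of Γ
Delay : Player → Run → Run → Set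
Delay ℘ Υ Γ =
  (∀ p → onlyP p Υ ≈ onlyP p Γ) ×
  (∀ n k i j → PosNth ℘ Γ n i → PosNth (opp ℘) Γ k j → j < i →
     ∀ i' j' → PosNth ℘ Υ n i' → PosNth (opp ℘) Υ k j' → j' < i')

-- Lr : the legal runs;  TopWins Γ : Wn⟨Γ⟩ = ⊤  (meaningful for legal Γ)
record Game : Set₁ where
  constructor mkGame
  field
    Lr      : Run → Set
    TopWins : Run → Set
open Game public

WnIs : Game → Run → Player → Set
WnIs G Γ top = TopWins G Γ
WnIs G Γ bot = ¬ TopWins G Γ

record IsGame (G : Game) : Set where
  field
    nonempty      : Σ Run (Lr G)
    prefixClosed  : ∀ Γ n → Lr G Γ → Lr G (restrict Γ n)
    limitClosed   : ∀ Γ → (∀ n → Lr G (restrict Γ n)) → Lr G Γ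
    respectsLr    : ∀ Γ Δ → Γ ≈ Δ → Lr G Γ → Lr G Δ
    respectsWn    : ∀ Γ Δ → Γ ≈ Δ → Lr G Γ → TopWins G Γ → TopWins G Δ

-- Γ is ℘-legal: legal, or the last labmove of its shortest illegal
-- initial segment (the one ending at step n) is (opp ℘)-labeled
LegalFor : Player → Game → Run → Set
LegalFor ℘ G Γ =
  Lr G Γ ⊎
  (Σ ℕ λ n → Σ Move λ m →
     Lr G (restrict Γ n) × (Γ n ≡ just (opp ℘ , m)) × ¬ Lr G (restrict Γ (suc n)))

WonBy : Player → Game → Run → Set
WonBy ℘ G Γ = (Lr G Γ × WnIs G Γ ℘) ⊎ ¬ LegalFor (opp ℘) G Γ

Static : Game → Set
Static G = ∀ ℘ Γ Υ → Delay ℘ Υ Γ →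
  (LegalFor ℘ G Γ → LegalFor ℘ G Υ) × (WonBy ℘ G Γ → WonBy ℘ G Υ)

negG : Game → Game
negG G = mkGame (λ Γ → Lr G (flipR Γ)) (λ Γ → ¬ TopWins G (flipR Γ))

data Cirq : Set where
  ⊤c  : Cirq
  ⊥c  : Cirq
  lit : Lit → Cirq
  _∨c_ : Cirq → Cirq → Cirq
  _∧c_ : Cirq → Cirq → Cirq
  ⊓c  : Cluster → Cirq → Cirq → Cirq
  ⊔c  : Cluster → Cirq → Cirq → Cirq

Interp : Set₁
Interp = Letter → Game

litGame : Interp → Lit → Game
litGame I (pos P a) = I P
litGame I (neg P a) = negG (I P)

projStep : Lit → Maybe Labmove → Maybe Labmove
projStep L (just (p , litMv L' α)) = if L ==ᴸ L' then just (p , α) else nothing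
projStep L _ = nothing

proj : Lit → Run → Run
proj L Γ i = projStep L (Γ i)

OkLab : Player → Move → Set
OkLab p   (litMv L α) = ⊤
OkLab bot (⊓mv c i)   = ⊤
OkLab top (⊔mv c i)   = ⊤
OkLab _   _           = ⊥

LrC : Interp → Run → Set
LrC I Γ =
  (∀ n p m → Γ n ≡ just (p , m) → OkLab p m) ×
  (∀ L → Lr (litGame I L) (proj L Γ)) ×
  (∀ c i j n k → Γ n ≡ just (bot , ⊓mv c i) → Γ k ≡ just (bot , ⊓mv c j) → n ≡ k) ×
  (∀ c i j n k → Γ n ≡ just (top , ⊔mv c i) → Γ k ≡ just (top , ⊔mv c j) → n ≡ k)

selSet : Fin 2 → Set → Set → Set
selSet zero    X Y = X
selSet (suc _) X Y = Y

TopWinsC : Interp → Cirq → Run → Set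
TopWinsC I ⊤c Γ = ⊤
TopWinsC I ⊥c Γ = ⊥
TopWinsC I (lit L) Γ = TopWins (litGame I L) (proj L Γ)
TopWinsC I (A ∨c B) Γ =
  WonBy top (mkGame (LrC I) (TopWinsC I A)) Γ ⊎ WonBy top (mkGame (LrC I) (TopWinsC I B)) Γ
TopWinsC I (A ∧c B) Γ =
  WonBy top (mkGame (LrC I) (TopWinsC I A)) Γ × WonBy top (mkGame (LrC I) (TopWinsC I B)) Γ
-- resolved with i: ⊤-won in the resolvent; unresolved: won by ⊤
TopWinsC I (⊓c c A B) Γ = ∀ i n → Γ n ≡ just (bot , ⊓mv c i) →
  selSet i (WonBy top (mkGame (LrC I) (TopWinsC I A)) Γ)
           (WonBy top (mkGame (LrC I) (TopWinsC I B)) Γ)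
-- resolved with i: ⊤-won in the resolvent; unresolved: won by ⊥
TopWinsC I (⊔c c A B) Γ = Σ (Fin 2) λ i → Σ ℕ λ n → (Γ n ≡ just (top , ⊔mv c i)) ×
  selSet i (WonBy top (mkGame (LrC I) (TopWinsC I A)) Γ)
           (WonBy top (mkGame (LrC I) (TopWinsC I B)) Γ)

cirqGame : Interp → Cirq → Game
cirqGame I C = mkGame (LrC I) (TopWinsC I C)

{-# OPTIONS --safe #-}
-- Delaying ℘'s moves commutes with projecting a run onto a literal and keeps every cluster
-- choice, so by induction on C a legal run of C* and its legal delays have the same winner, the
-- literal games being static (negation preserves staticity).
-- For legality: classically, a game obeying the legality axioms is static once its winner is
-- delay-invariant and an illegal move of opp ℘ stays illegal when ℘ delays its own moves.
-- Static games have this persistence: otherwise, dropping opp ℘'s moves after the offending one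
-- would make the delay opp ℘-legal, while the original, an opp ℘-delay of it, still moves
-- illegally. Persistence passes from the literal games to C*, since legality in C* is checked
-- literal by literal apart from the rule that a cluster is chosen only once, and a repeated
-- choice stays repeated in the delay because the chooser's moves keep their order.
module Submission where

open import Defs
open import Level using (0ℓ)
open import Axiom.ExcludedMiddle using (ExcludedMiddle)
open import Axiom.DoubleNegationElimination using (em⇒dne)
open import Data.Nat using (ℕ; zero; suc; _+_; _≤_; _<_; _≤′_; ≤′-refl; ≤′-step; s≤s; _<ᵇ_)
open import Data.Nat.Properties
open import Data.Maybe using (Maybe; just; nothing)
open import Data.Maybe.Properties using (just-injective)
open import Data.Product as Product using (Σ; _×_; _,_; proj₁; proj₂; uncurry)
open import Data.Sum as Sum using (_⊎_; inj₁; inj₂)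
open import Data.Empty using (⊥-elim)
open import Data.Bool using (true; false; if_then_else_)
open import Data.List using (List; []; _∷_; _++_; fromMaybe; length; mapMaybe)
open import Data.Fin using (Fin; zero; suc)
open import Function using (_∘_)
open import Relation.Nullary using (¬_; yes; no; contradiction)
open import Relation.Nullary.Reflects using (ofʸ; ofⁿ)
open import Relation.Binary.PropositionalEquality
open import Relation.Binary.Definitions using (tri<; tri≈; tri>)

-- Runs

≢-opp : ∀ p → p ≢ opp p
≢-opp top ()
≢-opp bot ()

≡⊎≡-opp : ∀ p ℘ → p ≡ ℘ ⊎ p ≡ opp ℘
≡⊎≡-opp top top = inj₁ refl
≡⊎≡-opp bot bot = inj₁ refl
≡⊎≡-opp top bot = inj₂ refl
≡⊎≡-opp bot top = inj₂ refl

countMoves-cong : ∀ {X Y} → X ≗ Y → countMoves X ≗ countMoves Y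
countMoves-cong X≗Y zero    = refl
countMoves-cong X≗Y (suc i) = cong₂ _+_ (countMoves-cong X≗Y i) (cong isMove (X≗Y i))

countMoves-mono : ∀ X {i j} → i ≤ j → countMoves X i ≤ countMoves X j
countMoves-mono X i≤j = go (≤⇒≤′ i≤j)
  where
  go : ∀ {i j} → i ≤′ j → countMoves X i ≤ countMoves X j
  go ≤′-refl        = ≤-refl
  go (≤′-step i≤′j) = ≤-trans (go i≤′j) (m≤m+n _ _)

countMoves-suc-at-move : ∀ X {i x} → X i ≡ just x → countMoves X (suc i) ≡ suc (countMoves X i)
countMoves-suc-at-move X {i} Xi rewrite Xi = +-comm (countMoves X i) 1

countMoves-<-from-move : ∀ X {i j x} → X i ≡ just x → i < j → countMoves X i < countMoves X j
countMoves-<-from-move X {j = j} Xi i<j =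
  subst (_≤ countMoves X j) (countMoves-suc-at-move X Xi) (countMoves-mono X i<j)

countMoves-reflects-< : ∀ X {i j} → countMoves X i < countMoves X j → i < j
countMoves-reflects-< X lt = ≰⇒> (λ j≤i → <⇒≱ lt (countMoves-mono X j≤i))

countMoves-reflects-≤ : ∀ X {i j x} → X j ≡ just x → countMoves X i ≤ countMoves X j → i ≤ j
countMoves-reflects-≤ X Xj le = ≮⇒≥ (λ j<i → <⇒≱ (countMoves-<-from-move X Xj j<i) le)

countMoves-injective : ∀ X {i j x y} → X i ≡ just x → X j ≡ just y →
                       countMoves X i ≡ countMoves X j → i ≡ j
countMoves-injective X Xi Xj eq =
  ≤-antisym (countMoves-reflects-≤ X Xj (≤-reflexive eq)) (countMoves-reflects-≤ X Xi (≤-reflexive (sym eq)))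

≈-sym : ∀ {X Y} → X ≈ Y → Y ≈ X
≈-sym X≈Y n x = proj₂ (X≈Y n x) , proj₁ (X≈Y n x)

≈-trans : ∀ {X Y Z} → X ≈ Y → Y ≈ Z → X ≈ Z
≈-trans X≈Y Y≈Z n x = proj₁ (Y≈Z n x) ∘ proj₁ (X≈Y n x) , proj₂ (X≈Y n x) ∘ proj₂ (Y≈Z n x)

≗⇒≈ : ∀ {X Y} → X ≗ Y → X ≈ Y
≗⇒≈ X≗Y n x = (λ { (i , Xi , c) → i , trans (sym (X≗Y i)) Xi , trans (sym (countMoves-cong X≗Y i)) c })
            , (λ { (i , Yi , c) → i , trans (X≗Y i) Yi , trans (countMoves-cong X≗Y i) c })

movesBefore : Run → ℕ → List Labmove
movesBefore X zero    = []
movesBefore X (suc i) = fromMaybe (X i) ++ movesBefore X i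

movesBefore-none : ∀ X i → countMoves X i ≡ 0 → movesBefore X i ≡ []
movesBefore-none X zero    _ = refl
movesBefore-none X (suc i) c with X i
... | nothing = movesBefore-none X i (m+n≡0⇒m≡0 _ c)
... | just _  = contradiction (m+n≡0⇒n≡0 (countMoves X i) c) λ ()

movesBefore-last : ∀ X i {N} → countMoves X i ≡ suc N →
  Σ ℕ λ p → Σ Labmove λ x → X p ≡ just x × countMoves X p ≡ N × movesBefore X i ≡ x ∷ movesBefore X p
movesBefore-last X zero    ()
movesBefore-last X (suc i) c with X i in Xi
... | nothing = movesBefore-last X i (trans (sym (+-identityʳ (countMoves X i))) c)
... | just x  = i , x , Xi , suc-injective (trans (+-comm 1 _) c) , refl

movesBefore-≈ : ∀ {X Y} → X ≈ Y → ∀ N i i' → countMoves X i ≡ N → countMoves Y i' ≡ N →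
                movesBefore X i ≡ movesBefore Y i'
movesBefore-≈ {X} {Y} _ zero i i' c c' = trans (movesBefore-none X i c) (sym (movesBefore-none Y i' c'))
movesBefore-≈ {X} {Y} X≈Y (suc N) i i' c c'
  with movesBefore-last X i c | movesBefore-last Y i' c'
... | p , x , Xp , cp , eX | q , y , Yq , cq , eY
  with proj₁ (X≈Y N x) (p , Xp , cp)
... | q' , Yq' , cq' with countMoves-injective Y Yq' Yq (trans cq' (sym cq))
... | refl = begin
  movesBefore X i       ≡⟨ eX ⟩
  x ∷ movesBefore X p   ≡⟨ cong₂ _∷_ (just-injective (trans (sym Yq') Yq)) (movesBefore-≈ X≈Y N p q cp cq) ⟩
  y ∷ movesBefore Y q   ≡⟨ sym eY ⟩
  movesBefore Y i'      ∎
  where open ≡-Reasoning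

StepMap : Set
StepMap = Maybe Labmove → Maybe Labmove

countMoves-map : ∀ (g : StepMap) → g nothing ≡ nothing → ∀ X i →
                 countMoves (g ∘ X) i ≡ length (mapMaybe (g ∘ just) (movesBefore X i))
countMoves-map g g-nothing X zero = refl
countMoves-map g g-nothing X (suc i) with X i
... | nothing rewrite g-nothing = trans (+-identityʳ (countMoves (g ∘ X) i)) (countMoves-map g g-nothing X i)
... | just x with g (just x)
...   | nothing = trans (+-identityʳ (countMoves (g ∘ X) i)) (countMoves-map g g-nothing X i)
...   | just _  = trans (+-comm (countMoves (g ∘ X) i) 1) (cong suc (countMoves-map g g-nothing X i))

countMoves-map-≈ : ∀ (g : StepMap) → g nothing ≡ nothing → ∀ {X Y} → X ≈ Y → ∀ i i' →
                   countMoves X i ≡ countMoves Y i' → countMoves (g ∘ X) i ≡ countMoves (g ∘ Y) i'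
countMoves-map-≈ g g-nothing {X} {Y} X≈Y i i' eq = begin
  countMoves (g ∘ X) i                              ≡⟨ countMoves-map g g-nothing X i ⟩
  length (mapMaybe (g ∘ just) (movesBefore X i))   ≡⟨ cong (length ∘ mapMaybe (g ∘ just))
                                                           (movesBefore-≈ X≈Y _ i i' refl (sym eq)) ⟩
  length (mapMaybe (g ∘ just) (movesBefore Y i'))  ≡⟨ sym (countMoves-map g g-nothing Y i') ⟩
  countMoves (g ∘ Y) i'                             ∎
  where open ≡-Reasoning

map-≈ : ∀ (g : StepMap) → g nothing ≡ nothing → ∀ {X Y} → X ≈ Y → (g ∘ X) ≈ (g ∘ Y)
map-≈ g g-nothing X≈Y n x = transfer X≈Y , transfer (≈-sym X≈Y)
  where
  transfer : ∀ {X Y} → X ≈ Y → NthMove (g ∘ X) n x → NthMove (g ∘ Y) n x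
  transfer {X} X≈Y (i , gXi , c) with X i in Xi
  ... | nothing = contradiction (trans (sym g-nothing) gXi) λ ()
  ... | just y with proj₁ (X≈Y _ y) (i , Xi , refl)
  ...   | i' , Yi' , c' = i' , trans (cong g Yi') gXi , trans (sym (countMoves-map-≈ g g-nothing X≈Y i i' (sym c'))) c

restrict-< : ∀ X {n i} → i < n → restrict X n i ≡ X i
restrict-< X {n} {i} i<n with i <ᵇ n | <ᵇ-reflects-< i n
... | true  | _        = refl
... | false | ofⁿ i≮n = contradiction i<n i≮n

restrict-≥ : ∀ X {n i} → n ≤ i → restrict X n i ≡ nothing
restrict-≥ X {n} {i} n≤i with i <ᵇ n | <ᵇ-reflects-< i n
... | true  | ofʸ i<n = contradiction i<n (≤⇒≯ n≤i)
... | false | _        = refl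

restrict-just : ∀ X {n i y} → restrict X n i ≡ just y → i < n × X i ≡ just y
restrict-just X {n} {i} e with i <ᵇ n | <ᵇ-reflects-< i n
... | true  | ofʸ i<n = i<n , e

restrict-suc-just : ∀ X {j i y} → restrict X (suc j) i ≡ just y → X i ≡ just y × (i < j ⊎ i ≡ j)
restrict-suc-just X {j} e with restrict-just X {suc j} e
... | i<1+j , Xi = Xi , m≤n⇒m<n∨m≡n (≤-pred i<1+j)

restrict-ext : ∀ {X Y} n → (∀ i → i < n → X i ≡ Y i) → restrict X n ≗ restrict Y n
restrict-ext n agree i with i <ᵇ n | <ᵇ-reflects-< i n
... | true  | ofʸ i<n = agree i i<n
... | false | _        = refl

restrict-restrict : ∀ X {m n} → m ≤ n → restrict (restrict X n) m ≗ restrict X m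
restrict-restrict X m≤n = restrict-ext _ (λ i i<m → restrict-< X (≤-trans i<m m≤n))

restrict-map : ∀ (g : StepMap) → g nothing ≡ nothing → ∀ X n → g ∘ restrict X n ≗ restrict (g ∘ X) n
restrict-map g g-nothing X n i with i <ᵇ n
... | true  = refl
... | false = g-nothing

restrict-suc-nothing : ∀ X {j} → X j ≡ nothing → restrict X (suc j) ≗ restrict X j
restrict-suc-nothing X {j} Xj i with <-cmp i j
... | tri< i<j _ _  = trans (restrict-< X (m<n⇒m<1+n i<j)) (sym (restrict-< X i<j))
... | tri≈ _ refl _ = trans (restrict-< X ≤-refl) (trans Xj (sym (restrict-≥ X ≤-refl)))
... | tri> _ _ j<i  = trans (restrict-≥ X j<i) (sym (restrict-≥ X (<⇒≤ j<i)))

keepP-self : ∀ q m → keepP q (just (q , m)) ≡ just (q , m)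
keepP-self top m = refl
keepP-self bot m = refl

keepP-just : ∀ q y {x} → keepP q y ≡ just x → y ≡ just x × proj₁ x ≡ q
keepP-just top (just (top , m)) refl = refl , refl
keepP-just bot (just (bot , m)) refl = refl , refl

onlyP-just : ∀ q X {i m} → X i ≡ just (q , m) → onlyP q X i ≡ just (q , m)
onlyP-just q X Xi = trans (cong (keepP q) Xi) (keepP-self q _)

correspondingMove : ∀ {q} Γ Υ → onlyP q Γ ≈ onlyP q Υ → ∀ {n m} → Γ n ≡ just (q , m) →
  Σ ℕ λ n' → Υ n' ≡ just (q , m) × countMoves (onlyP q Γ) n ≡ countMoves (onlyP q Υ) n'
correspondingMove {q} Γ Υ Γ≈Υ {n} {m} Γn
  with proj₁ (Γ≈Υ (countMoves (onlyP q Γ) n) (q , m)) (n , onlyP-just q Γ Γn , refl)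
... | n' , Υn' , c = n' , proj₁ (keepP-just q (Υ n') Υn') , sym c

-- Delays

KeepsOrder : Player → Player → Run → Run → Set
KeepsOrder p q Γ Υ = ∀ n k i j → PosNth p Γ n i → PosNth q Γ k j → j < i →
                     ∀ i' j' → PosNth p Υ n i' → PosNth q Υ k j' → j' < i'

PosNth-label : ∀ {p q} X {n k i} → PosNth p X n i → PosNth q X k i → p ≡ q
PosNth-label X (_ , Xi , _) (_ , Xi' , _) = cong proj₁ (just-injective (trans (sym Xi) Xi'))

KeepsOrder-swap : ∀ {p q Γ Υ} → p ≢ q → KeepsOrder p q Γ Υ → KeepsOrder q p Υ Γ
KeepsOrder-swap {Γ = Γ} p≢q keeps n k i j a b j<i i' j' c d with <-cmp j' i'
... | tri< j'<i' _ _ = j'<i'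
... | tri≈ _ refl _  = contradiction (PosNth-label Γ d c) p≢q
... | tri> _ _ i'<j' = contradiction (keeps k n j' i' d c i'<j' j i b a) (<-asym j<i)

Delay-swap : ∀ {℘ Υ Γ} → Delay ℘ Υ Γ → Delay (opp ℘) Γ Υ
Delay-swap {top} (same , keeps) = (λ p → ≈-sym (same p)) , KeepsOrder-swap (λ ()) keeps
Delay-swap {bot} (same , keeps) = (λ p → ≈-sym (same p)) , KeepsOrder-swap (λ ()) keeps

keepP-projStep : ∀ q L y → keepP q (projStep L y) ≡ projStep L (keepP q y)
keepP-projStep q L nothing = refl
keepP-projStep q L (just (p , m)) with p ==ᴾ q in pq
keepP-projStep q L (just (p , atom _))     | true  = refl
keepP-projStep q L (just (p , ⊓mv _ _))    | true  = refl
keepP-projStep q L (just (p , ⊔mv _ _))    | true  = refl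
keepP-projStep q L (just (p , litMv L' α)) | true with L ==ᴸ L'
... | true rewrite pq = refl
... | false = refl
keepP-projStep q L (just (p , atom _))     | false = refl
keepP-projStep q L (just (p , ⊓mv _ _))    | false = refl
keepP-projStep q L (just (p , ⊔mv _ _))    | false = refl
keepP-projStep q L (just (p , litMv L' α)) | false with L ==ᴸ L'
... | true rewrite pq = refl
... | false = refl

onlyP-proj : ∀ q L X → onlyP q (proj L X) ≗ projStep L ∘ onlyP q X
onlyP-proj q L X i = keepP-projStep q L (X i)

projStep-just : ∀ L y {p α} → projStep L y ≡ just (p , α) →
                Σ Lit λ L' → y ≡ just (p , litMv L' α) × (L ==ᴸ L') ≡ true
projStep-just L (just (p , litMv L' β)) e with L ==ᴸ L' in eq
projStep-just L (just (p , litMv L' β)) refl | true = L' , refl , eq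

projStep-litMv : ∀ L {p L' α} → (L ==ᴸ L') ≡ true → projStep L (just (p , litMv L' α)) ≡ just (p , α)
projStep-litMv L eq rewrite eq = refl

countMoves-proj-≈ : ∀ q L Γ Υ → onlyP q Γ ≈ onlyP q Υ → ∀ a b →
  countMoves (onlyP q Γ) a ≡ countMoves (onlyP q Υ) b →
  countMoves (onlyP q (proj L Γ)) a ≡ countMoves (onlyP q (proj L Υ)) b
countMoves-proj-≈ q L Γ Υ Γ≈Υ a b eq = begin
  countMoves (onlyP q (proj L Γ)) a    ≡⟨ countMoves-cong (onlyP-proj q L Γ) a ⟩
  countMoves (projStep L ∘ onlyP q Γ) a ≡⟨ countMoves-map-≈ (projStep L) refl Γ≈Υ a b eq ⟩
  countMoves (projStep L ∘ onlyP q Υ) b ≡⟨ sym (countMoves-cong (onlyP-proj q L Υ) b) ⟩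
  countMoves (onlyP q (proj L Υ)) b    ∎
  where open ≡-Reasoning

PosNth-proj : ∀ q L Γ Υ → onlyP q Γ ≈ onlyP q Υ → ∀ {n i i'} →
  PosNth q (proj L Γ) n i → PosNth q (proj L Υ) n i' → Σ ℕ λ N → PosNth q Γ N i × PosNth q Υ N i'
PosNth-proj q L Γ Υ Γ≈Υ {n} {i} {i'} (α , projΓi , cΓ) (_ , projΥi' , cΥ)
  with projStep-just L (Γ i) projΓi
... | L' , Γi , L≡L' with correspondingMove Γ Υ Γ≈Υ Γi
... | i'' , Υi'' , c with countMoves-injective (onlyP q (proj L Υ)) {i''} {i'}
       (onlyP-just q (proj L Υ) (trans (cong (projStep L) Υi'') (projStep-litMv L L≡L')))
       (onlyP-just q (proj L Υ) projΥi')
       (trans (sym (countMoves-proj-≈ q L Γ Υ Γ≈Υ i i'' c)) (trans cΓ (sym cΥ)))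
... | refl = countMoves (onlyP q Γ) i , (litMv L' α , Γi , refl) , (litMv L' α , Υi'' , sym c)

Delay-proj : ∀ {℘ Υ Γ} L → Delay ℘ Υ Γ → Delay ℘ (proj L Υ) (proj L Γ)
Delay-proj {℘} {Υ} {Γ} L (same , keeps) = same-proj , keeps-proj
  where
  same-proj : ∀ p → onlyP p (proj L Υ) ≈ onlyP p (proj L Γ)
  same-proj p = ≈-trans (≗⇒≈ (onlyP-proj p L Υ))
                  (≈-trans (map-≈ (projStep L) refl (same p)) (≈-sym (≗⇒≈ (onlyP-proj p L Γ))))
  keeps-proj : KeepsOrder ℘ (opp ℘) (proj L Γ) (proj L Υ)
  keeps-proj n k i j a b j<i i' j' c d
    with PosNth-proj ℘ L Γ Υ (≈-sym (same ℘)) a c | PosNth-proj (opp ℘) L Γ Υ (≈-sym (same (opp ℘))) b d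
  ... | N , a' , c' | K , b' , d' = keeps N K i j a' b' j<i i' j' c' d'

flipLab-just : ∀ y p {m} → flipLab y ≡ just (opp p , m) → y ≡ just (p , m)
flipLab-just (just (top , m)) top refl = refl
flipLab-just (just (bot , m)) bot refl = refl

keepP-flipLab : ∀ p y → keepP (opp p) (flipLab y) ≡ flipLab (keepP p y)
keepP-flipLab p   nothing          = refl
keepP-flipLab top (just (top , m)) = refl
keepP-flipLab top (just (bot , m)) = refl
keepP-flipLab bot (just (top , m)) = refl
keepP-flipLab bot (just (bot , m)) = refl

onlyP-flipR : ∀ p X → onlyP (opp p) (flipR X) ≗ flipR (onlyP p X)
onlyP-flipR p X i = keepP-flipLab p (X i)

countMoves-flipR : ∀ X → countMoves (flipR X) ≗ countMoves X
countMoves-flipR X zero    = refl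
countMoves-flipR X (suc i) = cong₂ _+_ (countMoves-flipR X i) (isMove-flipLab (X i))
  where
  isMove-flipLab : ∀ y → isMove (flipLab y) ≡ isMove y
  isMove-flipLab nothing  = refl
  isMove-flipLab (just _) = refl

PosNth-flipR : ∀ p X {n i} → PosNth (opp p) (flipR X) n i → PosNth p X n i
PosNth-flipR p X {n} {i} (m , Xi , c) =
  m , flipLab-just (X i) p Xi ,
  trans (sym (trans (countMoves-cong (onlyP-flipR p X) i) (countMoves-flipR (onlyP p X) i))) c

KeepsOrder-flipR : ∀ {p q Γ Υ} → KeepsOrder p q Γ Υ → KeepsOrder (opp p) (opp q) (flipR Γ) (flipR Υ)
KeepsOrder-flipR {p} {q} {Γ} {Υ} keeps n k i j a b j<i i' j' c d =
  keeps n k i j (PosNth-flipR p Γ a) (PosNth-flipR q Γ b) j<i i' j' (PosNth-flipR p Υ c) (PosNth-flipR q Υ d)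

Delay-flipR : ∀ {℘ Υ Γ} → Delay ℘ Υ Γ → Delay (opp ℘) (flipR Υ) (flipR Γ)
Delay-flipR {℘} {Υ} {Γ} (same , keeps) = same-flipR , KeepsOrder-flipR keeps
  where
  flipped : ∀ {p} → onlyP p Υ ≈ onlyP p Γ → onlyP (opp p) (flipR Υ) ≈ onlyP (opp p) (flipR Γ)
  flipped {p} Υ≈Γ = ≈-trans (≗⇒≈ (onlyP-flipR p Υ))
                      (≈-trans (map-≈ flipLab refl Υ≈Γ) (≈-sym (≗⇒≈ (onlyP-flipR p Γ))))
  same-flipR : ∀ p → onlyP p (flipR Υ) ≈ onlyP p (flipR Γ)
  same-flipR top = flipped (same bot)
  same-flipR bot = flipped (same top)

capOpp : Player → ℕ → Run → Run
capOpp ℘ n X i = if countMoves (onlyP (opp ℘) X) i <ᵇ n then X i else keepP ℘ (X i)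

takeMoves : ℕ → Run → Run
takeMoves n Z i = if countMoves Z i <ᵇ n then Z i else nothing

countMoves-takeMoves : ∀ n Z i → countMoves Z i ≤ n → countMoves (takeMoves n Z) i ≡ countMoves Z i
countMoves-takeMoves n Z zero    _ = refl
countMoves-takeMoves n Z (suc i) le with countMoves Z i <ᵇ n | <ᵇ-reflects-< (countMoves Z i) n
... | true  | _ = cong (_+ isMove (Z i)) (countMoves-takeMoves n Z i (≤-trans (m≤m+n _ _) le))
... | false | ofⁿ i≮n with Z i
...   | nothing = cong (_+ 0) (countMoves-takeMoves n Z i (≤-trans (m≤m+n _ _) le))
...   | just _  = contradiction (subst (_≤ n) (+-comm (countMoves Z i) 1) le) i≮n

takeMoves-< : ∀ n Z {i} → countMoves Z i < n → takeMoves n Z i ≡ Z i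
takeMoves-< n Z {i} lt with countMoves Z i <ᵇ n | <ᵇ-reflects-< (countMoves Z i) n
... | true  | _       = refl
... | false | ofⁿ ¬lt = contradiction lt ¬lt

takeMoves-≈ : ∀ n {Z Z'} → Z ≈ Z' → takeMoves n Z ≈ takeMoves n Z'
takeMoves-≈ n Z≈Z' N x = transfer Z≈Z' , transfer (≈-sym Z≈Z')
  where
  transfer : ∀ {Z Z'} → Z ≈ Z' → NthMove (takeMoves n Z) N x → NthMove (takeMoves n Z') N x
  transfer {Z} {Z'} Z≈Z' (i , Zi , c) with countMoves Z i <ᵇ n | <ᵇ-reflects-< (countMoves Z i) n
  ... | false | _      = contradiction Zi λ ()
  ... | true  | ofʸ lt with proj₁ (Z≈Z' (countMoves Z i) x) (i , Zi , refl)
  ...   | i' , Z'i' , c' = i' , trans (takeMoves-< n Z' lt') Z'i' , (begin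
    countMoves (takeMoves n Z') i' ≡⟨ countMoves-takeMoves n Z' i' (<⇒≤ lt') ⟩
    countMoves Z' i'               ≡⟨ c' ⟩
    countMoves Z i                 ≡⟨ sym (countMoves-takeMoves n Z i (<⇒≤ lt)) ⟩
    countMoves (takeMoves n Z) i   ≡⟨ c ⟩
    N                              ∎)
    where
    open ≡-Reasoning
    lt' : countMoves Z' i' < n
    lt' = subst (_< n) (sym c') lt

keepP-idem : ∀ p y → keepP p (keepP p y) ≡ keepP p y
keepP-idem p   nothing          = refl
keepP-idem top (just (top , m)) = refl
keepP-idem top (just (bot , m)) = refl
keepP-idem bot (just (top , m)) = refl
keepP-idem bot (just (bot , m)) = refl

keepP-opp : ∀ p y → keepP (opp p) (keepP p y) ≡ nothing
keepP-opp p   nothing          = refl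
keepP-opp top (just (top , m)) = refl
keepP-opp top (just (bot , m)) = refl
keepP-opp bot (just (top , m)) = refl
keepP-opp bot (just (bot , m)) = refl

onlyP-capOpp-self : ∀ ℘ n X → onlyP ℘ (capOpp ℘ n X) ≗ onlyP ℘ X
onlyP-capOpp-self ℘ n X i with countMoves (onlyP (opp ℘) X) i <ᵇ n
... | true  = refl
... | false = keepP-idem ℘ (X i)

onlyP-capOpp-opp : ∀ ℘ n X → onlyP (opp ℘) (capOpp ℘ n X) ≗ takeMoves n (onlyP (opp ℘) X)
onlyP-capOpp-opp ℘ n X i with countMoves (onlyP (opp ℘) X) i <ᵇ n
... | true  = refl
... | false = keepP-opp ℘ (X i)

capOpp-just : ∀ ℘ n X {i x} → capOpp ℘ n X i ≡ just x → X i ≡ just x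
capOpp-just ℘ n X {i} e with countMoves (onlyP (opp ℘) X) i <ᵇ n
... | true  = e
... | false = proj₁ (keepP-just ℘ (X i) e)

capOpp-opp-just : ∀ ℘ n X {i m} → capOpp ℘ n X i ≡ just (opp ℘ , m) → countMoves (onlyP (opp ℘) X) i < n
capOpp-opp-just ℘ n X {i} e
  with countMoves (onlyP (opp ℘) X) i <ᵇ n | <ᵇ-reflects-< (countMoves (onlyP (opp ℘) X) i) n
... | true  | ofʸ lt = lt
... | false | _      = contradiction (proj₂ (keepP-just ℘ (X i) e)) (≢-opp ℘ ∘ sym)

PosNth-capOpp-self : ∀ ℘ n X {k i} → PosNth ℘ (capOpp ℘ n X) k i → PosNth ℘ X k i
PosNth-capOpp-self ℘ n X {k} {i} (m , e , c) =
  m , capOpp-just ℘ n X e , trans (sym (countMoves-cong (onlyP-capOpp-self ℘ n X) i)) c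

PosNth-capOpp-opp : ∀ ℘ n X {k i} → PosNth (opp ℘) (capOpp ℘ n X) k i → PosNth (opp ℘) X k i
PosNth-capOpp-opp ℘ n X {k} {i} (m , e , c) =
  m , capOpp-just ℘ n X e ,
  trans (sym (trans (countMoves-cong (onlyP-capOpp-opp ℘ n X) i)
                    (countMoves-takeMoves n (onlyP (opp ℘) X) i (<⇒≤ (capOpp-opp-just ℘ n X e))))) c

Delay-capOpp : ∀ {℘ Υ Γ} n → Delay ℘ Υ Γ → Delay ℘ (capOpp ℘ n Υ) (capOpp ℘ n Γ)
Delay-capOpp {℘} {Υ} {Γ} n (same , keeps) = same-cap , keeps-cap
  where
  same-cap : ∀ p → onlyP p (capOpp ℘ n Υ) ≈ onlyP p (capOpp ℘ n Γ)
  same-cap p with ≡⊎≡-opp p ℘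
  ... | inj₁ refl = ≈-trans (≗⇒≈ (onlyP-capOpp-self ℘ n Υ))
                      (≈-trans (same ℘) (≈-sym (≗⇒≈ (onlyP-capOpp-self ℘ n Γ))))
  ... | inj₂ refl = ≈-trans (≗⇒≈ (onlyP-capOpp-opp ℘ n Υ))
                      (≈-trans (takeMoves-≈ n (same (opp ℘))) (≈-sym (≗⇒≈ (onlyP-capOpp-opp ℘ n Γ))))
  keeps-cap : KeepsOrder ℘ (opp ℘) (capOpp ℘ n Γ) (capOpp ℘ n Υ)
  keeps-cap k l i j a b j<i i' j' c d =
    keeps k l i j (PosNth-capOpp-self ℘ n Γ a) (PosNth-capOpp-opp ℘ n Γ b) j<i
          i' j' (PosNth-capOpp-self ℘ n Υ c) (PosNth-capOpp-opp ℘ n Υ d)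

capOpp-agrees : ∀ ℘ n X {j} → countMoves (onlyP (opp ℘) X) j < n → ∀ t → t ≤ j → capOpp ℘ n X t ≡ X t
capOpp-agrees ℘ n X lt t t≤j
  with countMoves (onlyP (opp ℘) X) t <ᵇ n | <ᵇ-reflects-< (countMoves (onlyP (opp ℘) X) t) n
... | true  | _      = refl
... | false | ofⁿ ¬lt = contradiction (≤-<-trans (countMoves-mono (onlyP (opp ℘) X) t≤j) lt) ¬lt

restrict-capOpp : ∀ ℘ n X {j N} → countMoves (onlyP (opp ℘) X) j < n → N ≤ suc j →
                  restrict (capOpp ℘ n X) N ≗ restrict X N
restrict-capOpp ℘ n X lt N≤1+j =
  restrict-ext _ (λ t t<N → capOpp-agrees ℘ n X lt t (≤-pred (≤-trans t<N N≤1+j)))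

-- Legality and static games

-- Invariance is required under ≗ only, not ≈: that is all the cirquent games are shown to satisfy.
record LrAxioms (G : Game) : Set where
  field
    respects-≗   : ∀ {X Y} → X ≗ Y → Lr G X → Lr G Y
    prefixClosed : ∀ X n → Lr G X → Lr G (restrict X n)
    limitClosed  : ∀ X → (∀ n → Lr G (restrict X n)) → Lr G X
    emptyLegal   : Lr G emptyRun

  prefixClosed-≤ : ∀ X {m n} → m ≤ n → Lr G (restrict X n) → Lr G (restrict X m)
  prefixClosed-≤ X {m} m≤n legal = respects-≗ (restrict-restrict X m≤n) (prefixClosed _ m legal)

IsGame⇒LrAxioms : ∀ {G} → IsGame G → LrAxioms G
IsGame⇒LrAxioms isGame = record
  { respects-≗   = λ X≗Y → respectsLr _ _ (≗⇒≈ X≗Y)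
  ; prefixClosed = prefixClosed
  ; limitClosed  = limitClosed
  ; emptyLegal   = prefixClosed (proj₁ nonempty) 0 (proj₂ nonempty)
  }
  where open IsGame isGame

LrAxioms-negG : ∀ {G} → LrAxioms G → LrAxioms (negG G)
LrAxioms-negG ax = record
  { respects-≗   = λ X≗Y → respects-≗ (cong flipLab ∘ X≗Y)
  ; prefixClosed = λ X n legal → respects-≗ (sym ∘ restrict-map flipLab refl X n) (prefixClosed (flipR X) n legal)
  ; limitClosed  = λ X legal → limitClosed (flipR X) (λ n → respects-≗ (restrict-map flipLab refl X n) (legal n))
  ; emptyLegal   = emptyLegal
  }
  where open LrAxioms ax

NoIllegalMoveBy : Player → Game → Run → Set
NoIllegalMoveBy ℘ G Γ = ∀ n m → Γ n ≡ just (℘ , m) → Lr G (restrict Γ n) → Lr G (restrict Γ (suc n))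

legalFor⇒noIllegalMove : ∀ {G} → LrAxioms G → ∀ {℘ Γ} → LegalFor ℘ G Γ → NoIllegalMoveBy ℘ G Γ
legalFor⇒noIllegalMove ax (inj₁ legal) n _ _ _ = LrAxioms.prefixClosed ax _ (suc n) legal
legalFor⇒noIllegalMove ax {℘} (inj₂ (j , _ , legalBefore , Γj , illegalAt)) n _ Γn legalBeforeN
  with <-cmp n j
... | tri< n<j _ _  = LrAxioms.prefixClosed-≤ ax _ n<j legalBefore
... | tri≈ _ refl _ = contradiction (cong proj₁ (just-injective (trans (sym Γn) Γj))) (≢-opp ℘)
... | tri> _ _ j<n  = contradiction (LrAxioms.prefixClosed-≤ ax _ j<n legalBeforeN) illegalAt

firstIllegalStep : ExcludedMiddle 0ℓ → ∀ {G} → LrAxioms G → ∀ {Γ} → ¬ Lr G Γ →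
                   Σ ℕ λ j → Lr G (restrict Γ j) × ¬ Lr G (restrict Γ (suc j))
firstIllegalStep em {G} ax {Γ} illegal = uncurry descend someIllegalPrefix
  where
  open LrAxioms ax
  someIllegalPrefix : Σ ℕ λ n → ¬ Lr G (restrict Γ n)
  someIllegalPrefix = em⇒dne em λ none → illegal (limitClosed Γ λ n → em⇒dne em λ ¬legal → none (n , ¬legal))
  descend : ∀ n → ¬ Lr G (restrict Γ n) → Σ ℕ λ j → Lr G (restrict Γ j) × ¬ Lr G (restrict Γ (suc j))
  descend zero    illegal₀ = contradiction emptyLegal illegal₀
  descend (suc n) illegalₙ₊₁ with em {Lr G (restrict Γ n)}
  ... | yes legalₙ   = n , legalₙ , illegalₙ₊₁
  ... | no illegalₙ = descend n illegalₙ

noIllegalMove⇒legalFor : ExcludedMiddle 0ℓ → ∀ {G} → LrAxioms G → ∀ {℘ Γ} →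
                         NoIllegalMoveBy ℘ G Γ → LegalFor ℘ G Γ
noIllegalMove⇒legalFor em {G} ax {℘} {Γ} noIllegal with em {Lr G Γ}
... | yes legal = inj₁ legal
... | no illegal with firstIllegalStep em ax illegal
...   | j , legalBefore , illegalAt with Γ j in Γj
...     | nothing = contradiction (LrAxioms.respects-≗ ax (sym ∘ restrict-suc-nothing Γ Γj) legalBefore) illegalAt
...     | just (p , m) with ≡⊎≡-opp p ℘
...       | inj₁ refl = contradiction (noIllegal j m Γj legalBefore) illegalAt
...       | inj₂ refl = inj₂ (j , m , legalBefore , Γj , illegalAt)

IllegalityPersists : Game → Set
IllegalityPersists G = ∀ ℘ Γ Υ → Delay ℘ Υ Γ → ∀ {j j' m} →
  Γ j ≡ just (opp ℘ , m) → Υ j' ≡ just (opp ℘ , m) →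
  countMoves (onlyP (opp ℘) Γ) j ≡ countMoves (onlyP (opp ℘) Υ) j' →
  Lr G (restrict Γ j) → ¬ Lr G (restrict Γ (suc j)) → ¬ Lr G (restrict Υ (suc j'))

static⇒illegalityPersists : ExcludedMiddle 0ℓ → ∀ {G} → LrAxioms G → Static G → IllegalityPersists G
static⇒illegalityPersists em {G} ax static ℘ Γ Υ delay {j} {j'} {m} Γj Υj' c legalBefore illegalAt legalΥ =
  illegalAt (respects-≗ (restrict-capOpp ℘ n Γ inΓ ≤-refl)
              (legalFor⇒noIllegalMove ax legalForΓ' j m Γ'j
                (respects-≗ (sym ∘ restrict-capOpp ℘ n Γ inΓ (n≤1+n j)) legalBefore)))
  where
  open LrAxioms ax
  n : ℕ
  n = suc (countMoves (onlyP (opp ℘) Γ) j)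
  inΓ : countMoves (onlyP (opp ℘) Γ) j < n
  inΓ = ≤-refl
  inΥ : countMoves (onlyP (opp ℘) Υ) j' < n
  inΥ = subst (_< n) c ≤-refl
  Γ'j : capOpp ℘ n Γ j ≡ just (opp ℘ , m)
  Γ'j = trans (capOpp-agrees ℘ n Γ inΓ j ≤-refl) Γj
  noIllegalΥ' : NoIllegalMoveBy (opp ℘) G (capOpp ℘ n Υ)
  noIllegalΥ' t _ Υ't _ =
    prefixClosed-≤ (capOpp ℘ n Υ) (s≤s t≤j') (respects-≗ (sym ∘ restrict-capOpp ℘ n Υ inΥ ≤-refl) legalΥ)
    where
    t≤j' : t ≤ j'
    t≤j' = countMoves-reflects-≤ (onlyP (opp ℘) Υ) (onlyP-just (opp ℘) Υ Υj')
             (subst (_ ≤_) c (≤-pred (capOpp-opp-just ℘ n Υ Υ't)))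
  legalForΓ' : LegalFor (opp ℘) G (capOpp ℘ n Γ)
  legalForΓ' = proj₁ (static (opp ℘) (capOpp ℘ n Υ) (capOpp ℘ n Γ) (Delay-swap (Delay-capOpp n delay)))
                     (noIllegalMove⇒legalFor em ax noIllegalΥ')

illegalityPersists-swap : ∀ {G} → IllegalityPersists G → ∀ ℘ Γ Υ → Delay ℘ Υ Γ → ∀ {i i₀ m} →
  Υ i ≡ just (℘ , m) → Γ i₀ ≡ just (℘ , m) →
  countMoves (onlyP ℘ Υ) i ≡ countMoves (onlyP ℘ Γ) i₀ →
  Lr G (restrict Υ i) → ¬ Lr G (restrict Υ (suc i)) → ¬ Lr G (restrict Γ (suc i₀))
illegalityPersists-swap persists top Γ Υ delay = persists bot Υ Γ (Delay-swap delay)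
illegalityPersists-swap persists bot Γ Υ delay = persists top Υ Γ (Delay-swap delay)

earlierIllegalMoveByOpp : ∀ {G} → LrAxioms G → ∀ {℘ Γ i m} → LegalFor ℘ G Γ →
  Γ i ≡ just (℘ , m) → ¬ Lr G (restrict Γ (suc i)) →
  Σ ℕ λ j → Σ Move λ m' → j < i × Γ j ≡ just (opp ℘ , m') ×
                           Lr G (restrict Γ j) × ¬ Lr G (restrict Γ (suc j))
earlierIllegalMoveByOpp ax {i = i} (inj₁ legal) _ illegalAfter =
  contradiction (LrAxioms.prefixClosed ax _ (suc i) legal) illegalAfter
earlierIllegalMoveByOpp ax {℘} {i = i} {m} legalFor@(inj₂ (j , m' , legalBefore , Γj , illegalAt)) Γi illegalAfter
  with <-cmp j i
... | tri< j<i _ _  = j , m' , j<i , Γj , legalBefore , illegalAt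
... | tri≈ _ refl _ = contradiction (cong proj₁ (just-injective (trans (sym Γi) Γj))) (≢-opp ℘)
... | tri> _ _ i<j  = contradiction (legalFor⇒noIllegalMove ax legalFor i m Γi
                        (LrAxioms.prefixClosed-≤ ax _ (<⇒≤ i<j) legalBefore)) illegalAfter

-- An illegal move of ℘ in Υ would, by persistence, be illegal in Γ too; as Γ is ℘-legal,
-- opp ℘ moved illegally before it in Γ, and so (by persistence again) before it in Υ.
illegalityPersists⇒legalFor-delay : ExcludedMiddle 0ℓ → ∀ {G} → LrAxioms G → IllegalityPersists G →
  ∀ ℘ Γ Υ → Delay ℘ Υ Γ → LegalFor ℘ G Γ → LegalFor ℘ G Υ
illegalityPersists⇒legalFor-delay em {G} ax persists ℘ Γ Υ delay@(same , keeps) legalΓ =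
  noIllegalMove⇒legalFor em ax noIllegalΥ
  where
  noIllegalΥ : NoIllegalMoveBy ℘ G Υ
  noIllegalΥ i m Υi legalBefore with em {Lr G (restrict Υ (suc i))}
  ... | yes legalAfter = legalAfter
  ... | no illegalAfter with correspondingMove Υ Γ (same ℘) Υi
  ... | i₀ , Γi₀ , c
    with earlierIllegalMoveByOpp ax legalΓ Γi₀
           (illegalityPersists-swap {G} persists ℘ Γ Υ delay Υi Γi₀ c legalBefore illegalAfter)
  ... | j , m' , j<i₀ , Γj , legalBeforeJ , illegalAtJ
    with correspondingMove Γ Υ (≈-sym (same (opp ℘))) Γj
  ... | j' , Υj' , c' =
    ⊥-elim (persists ℘ Γ Υ delay Γj Υj' c' legalBeforeJ illegalAtJ
             (LrAxioms.prefixClosed-≤ ax Υ j'<i legalBefore))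
    where
    j'<i : j' < i
    j'<i = keeps _ _ i₀ j (m , Γi₀ , refl) (m' , Γj , refl) j<i₀ i j' (m , Υi , c) (m' , Υj' , sym c')

TopWinsDelayClosed : Game → Set
TopWinsDelayClosed G = ∀ Γ Υ → Delay top Υ Γ → Lr G Γ → Lr G Υ → TopWins G Γ → TopWins G Υ

static⇒topWinsDelayClosed : ∀ {G} → Static G → TopWinsDelayClosed G
static⇒topWinsDelayClosed static Γ Υ delay legalΓ legalΥ wins
  with proj₂ (static top Γ Υ delay) (inj₁ (legalΓ , wins))
... | inj₁ (_ , winsΥ) = winsΥ
... | inj₂ ¬legalFor  = contradiction (inj₁ legalΥ) ¬legalFor

wnIs-delay : ∀ {G} → TopWinsDelayClosed G → ∀ ℘ {Γ Υ} → Delay ℘ Υ Γ →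
             Lr G Γ → Lr G Υ → WnIs G Γ ℘ → WnIs G Υ ℘
wnIs-delay topWins top {Γ} {Υ} delay legalΓ legalΥ wins = topWins Γ Υ delay legalΓ legalΥ wins
wnIs-delay topWins bot {Γ} {Υ} delay legalΓ legalΥ loses = loses ∘ topWins Υ Γ (Delay-swap delay) legalΥ legalΓ

static-from : ExcludedMiddle 0ℓ → ∀ {G} → LrAxioms G → IllegalityPersists G → TopWinsDelayClosed G → Static G
static-from em {G} ax persists topWins ℘ Γ Υ delay = legalFor-delay ℘ Γ Υ delay , wonBy-delay
  where
  legalFor-delay : ∀ ℘ Γ Υ → Delay ℘ Υ Γ → LegalFor ℘ G Γ → LegalFor ℘ G Υ
  legalFor-delay = illegalityPersists⇒legalFor-delay em ax persists
  wonBy-delay : WonBy ℘ G Γ → WonBy ℘ G Υ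
  wonBy-delay (inj₂ ¬legalFor) = inj₂ (¬legalFor ∘ legalFor-delay (opp ℘) Υ Γ (Delay-swap delay))
  wonBy-delay (inj₁ (legalΓ , wn)) with legalFor-delay ℘ Γ Υ delay (inj₁ legalΓ)
  ... | inj₁ legalΥ = inj₁ (legalΥ , wnIs-delay topWins ℘ delay legalΓ legalΥ wn)
  ... | inj₂ (n , m , legalBefore , Υn , illegalAt) =
    inj₂ λ legalForOpp → illegalAt (legalFor⇒noIllegalMove ax legalForOpp n m Υn legalBefore)

module _ {G : Game} (ax : LrAxioms G) where
  open LrAxioms ax

  legalFor-negG : ∀ ℘ {Γ} → LegalFor ℘ (negG G) Γ → LegalFor (opp ℘) G (flipR Γ)
  legalFor-negG ℘ (inj₁ legal) = inj₁ legal
  legalFor-negG ℘ {Γ} (inj₂ (n , m , legalBefore , Γn , illegalAt)) =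
    inj₂ (n , m , respects-≗ (restrict-map flipLab refl Γ n) legalBefore , cong flipLab Γn ,
          illegalAt ∘ respects-≗ (sym ∘ restrict-map flipLab refl Γ (suc n)))

  legalFor-negG⁻¹ : ∀ ℘ {Γ} → LegalFor (opp ℘) G (flipR Γ) → LegalFor ℘ (negG G) Γ
  legalFor-negG⁻¹ ℘ (inj₁ legal) = inj₁ legal
  legalFor-negG⁻¹ ℘ {Γ} (inj₂ (n , m , legalBefore , Γn , illegalAt)) =
    inj₂ (n , m , respects-≗ (sym ∘ restrict-map flipLab refl Γ n) legalBefore , flipLab-just (Γ n) (opp ℘) Γn ,
          illegalAt ∘ respects-≗ (restrict-map flipLab refl Γ (suc n)))

  wonBy-negG : ExcludedMiddle 0ℓ → ∀ ℘ {Γ} → WonBy ℘ (negG G) Γ → WonBy (opp ℘) G (flipR Γ)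
  wonBy-negG em top (inj₁ (legal , loses))  = inj₁ (legal , loses)
  wonBy-negG em bot (inj₁ (legal , ¬loses)) = inj₁ (legal , em⇒dne em ¬loses)
  wonBy-negG em ℘   (inj₂ ¬legalFor)        = inj₂ (¬legalFor ∘ legalFor-negG⁻¹ (opp ℘))

  wonBy-negG⁻¹ : ∀ ℘ {Γ} → WonBy (opp ℘) G (flipR Γ) → WonBy ℘ (negG G) Γ
  wonBy-negG⁻¹ top (inj₁ (legal , loses)) = inj₁ (legal , loses)
  wonBy-negG⁻¹ bot (inj₁ (legal , wins))  = inj₁ (legal , λ loses → loses wins)
  wonBy-negG⁻¹ ℘   (inj₂ ¬legalFor)       = inj₂ (¬legalFor ∘ legalFor-negG (opp ℘))

  Static-negG : ExcludedMiddle 0ℓ → Static G → Static (negG G)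
  Static-negG em static ℘ Γ Υ delay with static (opp ℘) (flipR Γ) (flipR Υ) (Delay-flipR delay)
  ... | legalFor-delay , wonBy-delay =
    legalFor-negG⁻¹ ℘ ∘ legalFor-delay ∘ legalFor-negG ℘ , wonBy-negG⁻¹ ℘ ∘ wonBy-delay ∘ wonBy-negG em ℘

-- Cirquent games

selSet-map : ∀ i {P Q P' Q' : Set} → (P → P') → (Q → Q') → selSet i P Q → selSet i P' Q'
selSet-map zero    f g = f
selSet-map (suc _) f g = g

WellLabelled : Run → Set
WellLabelled X = ∀ n p m → X n ≡ just (p , m) → OkLab p m

ChosenOnce : Player → (Cluster → Fin 2 → Move) → Run → Set
ChosenOnce q choice X = ∀ c i i' n k → X n ≡ just (q , choice c i) → X k ≡ just (q , choice c i') → n ≡ k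

module _ {q : Player} {choice : Cluster → Fin 2 → Move} where

  ChosenOnce-≗ : ∀ {X Y} → X ≗ Y → ChosenOnce q choice X → ChosenOnce q choice Y
  ChosenOnce-≗ X≗Y once c i i' n k e e' = once c i i' n k (trans (X≗Y n) e) (trans (X≗Y k) e')

  ChosenOnce-restrict : ∀ X N → ChosenOnce q choice X → ChosenOnce q choice (restrict X N)
  ChosenOnce-restrict X N once c i i' n k e e' =
    once c i i' n k (proj₂ (restrict-just X {N} e)) (proj₂ (restrict-just X {N} e'))

  ChosenOnce-limit : ∀ X → (∀ N → ChosenOnce q choice (restrict X N)) → ChosenOnce q choice X
  ChosenOnce-limit X once c i i' n k e e' =
    once (suc (n + k)) c i i' n k (trans (restrict-< X (s≤s (m≤m+n n k))) e)
                                  (trans (restrict-< X (s≤s (m≤n+m k n))) e')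

  noEarlierSameChoice : ∀ {℘ Γ Υ j j' m} → onlyP q Γ ≈ onlyP q Υ →
    Γ j ≡ just (opp ℘ , m) → Υ j' ≡ just (opp ℘ , m) →
    countMoves (onlyP (opp ℘) Γ) j ≡ countMoves (onlyP (opp ℘) Υ) j' →
    ChosenOnce q choice (restrict Υ (suc j')) →
    ∀ {b c i i'} → Γ j ≡ just (q , choice c i) → Γ b ≡ just (q , choice c i') → ¬ b < j
  noEarlierSameChoice {Γ = Γ} {Υ} {j' = j'} Γ≈Υ Γj Υj' count onceΥ {c = c} {i} {i'} Γj-choice Γb b<j
    with trans (sym Γj-choice) Γj
  ... | refl with correspondingMove Γ Υ Γ≈Υ Γb
  ... | b' , Υb' , countb = <-irrefl (onceΥ c i' i b' j' (trans (restrict-< Υ (m<n⇒m<1+n b'<j')) Υb')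
                                                          (trans (restrict-< Υ ≤-refl) Υj')) b'<j'
    where
    b'<j' : b' < j'
    b'<j' = countMoves-reflects-< (onlyP q Υ)
              (subst₂ _<_ countb count (countMoves-<-from-move (onlyP q Γ) (onlyP-just q Γ Γb) b<j))

  ChosenOnce-extend : ∀ {℘ Γ Υ j j' m} → onlyP q Γ ≈ onlyP q Υ →
    Γ j ≡ just (opp ℘ , m) → Υ j' ≡ just (opp ℘ , m) →
    countMoves (onlyP (opp ℘) Γ) j ≡ countMoves (onlyP (opp ℘) Υ) j' →
    ChosenOnce q choice (restrict Γ j) → ChosenOnce q choice (restrict Υ (suc j')) →
    ChosenOnce q choice (restrict Γ (suc j))
  ChosenOnce-extend {Γ = Γ} Γ≈Υ Γj Υj' count onceΓ onceΥ c i i' n k e e'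
    with restrict-suc-just Γ e | restrict-suc-just Γ e'
  ... | Γn , inj₁ n<j  | Γk , inj₁ k<j  =
    onceΓ c i i' n k (trans (restrict-< Γ n<j) Γn) (trans (restrict-< Γ k<j) Γk)
  ... | _  , inj₂ refl | _  , inj₂ refl = refl
  ... | Γn , inj₂ refl | Γk , inj₁ k<j  = ⊥-elim (noEarlierSameChoice Γ≈Υ Γj Υj' count onceΥ Γn Γk k<j)
  ... | Γn , inj₁ n<j  | Γk , inj₂ refl = ⊥-elim (noEarlierSameChoice Γ≈Υ Γj Υj' count onceΥ Γk Γn n<j)

module CirquentGame (em : ExcludedMiddle 0ℓ) (I : Interp)
  (litAxioms : ∀ L → LrAxioms (litGame I L)) (litStatic : ∀ L → Static (litGame I L)) where

  labels : ∀ {X} → LrC I X → WellLabelled X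
  labels (ok , _) = ok

  lits : ∀ {X} → LrC I X → ∀ L → Lr (litGame I L) (proj L X)
  lits (_ , legal , _) = legal

  once⊓ : ∀ {X} → LrC I X → ChosenOnce bot ⊓mv X
  once⊓ (_ , _ , once , _) = once

  once⊔ : ∀ {X} → LrC I X → ChosenOnce top ⊔mv X
  once⊔ (_ , _ , _ , once) = once

  litLr-restrict : ∀ L X n → Lr (litGame I L) (proj L (restrict X n)) → Lr (litGame I L) (restrict (proj L X) n)
  litLr-restrict L X n = LrAxioms.respects-≗ (litAxioms L) (restrict-map (projStep L) refl X n)

  litLr-restrict⁻¹ : ∀ L X n → Lr (litGame I L) (restrict (proj L X) n) → Lr (litGame I L) (proj L (restrict X n))
  litLr-restrict⁻¹ L X n = LrAxioms.respects-≗ (litAxioms L) (sym ∘ restrict-map (projStep L) refl X n)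

  cirqLrAxioms : ∀ C → LrAxioms (cirqGame I C)
  cirqLrAxioms C = record
    { respects-≗   = λ X≗Y legal →
        (λ n p m → labels legal n p m ∘ trans (X≗Y n)) ,
        (λ L → LrAxioms.respects-≗ (litAxioms L) (cong (projStep L) ∘ X≗Y) (lits legal L)) ,
        ChosenOnce-≗ X≗Y (once⊓ legal) , ChosenOnce-≗ X≗Y (once⊔ legal)
    ; prefixClosed = λ X N legal →
        (λ n p m → labels legal n p m ∘ proj₂ ∘ restrict-just X {N}) ,
        (λ L → litLr-restrict⁻¹ L X N (LrAxioms.prefixClosed (litAxioms L) (proj L X) N (lits legal L))) ,
        ChosenOnce-restrict X N (once⊓ legal) , ChosenOnce-restrict X N (once⊔ legal)
    ; limitClosed  = λ X legal →
        (λ n p m → labels (legal (suc n)) n p m ∘ trans (restrict-< X ≤-refl)) ,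
        (λ L → LrAxioms.limitClosed (litAxioms L) (proj L X) (λ N → litLr-restrict L X N (lits (legal N) L))) ,
        ChosenOnce-limit X (once⊓ ∘ legal) , ChosenOnce-limit X (once⊔ ∘ legal)
    ; emptyLegal   = (λ _ _ _ ()) , (λ L → LrAxioms.emptyLegal (litAxioms L)) , (λ _ _ _ _ _ ()) , (λ _ _ _ _ _ ())
    }

  litLegalAt : ∀ ℘ Γ Υ → Delay ℘ Υ Γ → ∀ {j j' m} →
    Γ j ≡ just (opp ℘ , m) → Υ j' ≡ just (opp ℘ , m) →
    countMoves (onlyP (opp ℘) Γ) j ≡ countMoves (onlyP (opp ℘) Υ) j' → ∀ L →
    Lr (litGame I L) (proj L (restrict Γ j)) → Lr (litGame I L) (proj L (restrict Υ (suc j'))) →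
    Lr (litGame I L) (proj L (restrict Γ (suc j)))
  litLegalAt ℘ Γ Υ delay {j} {j'} Γj Υj' count L legalBefore legalΥ with projStep L (Γ j) in projΓj
  ... | nothing = litLr-restrict⁻¹ L Γ (suc j)
                    (LrAxioms.respects-≗ (litAxioms L) (sym ∘ restrict-suc-nothing (proj L Γ) projΓj)
                      (litLr-restrict L Γ j legalBefore))
  ... | just (p , α) with projStep-just L (Γ j) projΓj
  ... | _ , Γj' , _ with trans (sym Γj') Γj
  ... | refl = em⇒dne em λ illegal →
    static⇒illegalityPersists em (litAxioms L) (litStatic L) ℘ (proj L Γ) (proj L Υ) (Delay-proj L delay)
      projΓj (trans (cong (projStep L) (trans Υj' (sym Γj))) projΓj)
      (countMoves-proj-≈ (opp ℘) L Γ Υ (≈-sym (proj₁ delay (opp ℘))) j j' count)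
      (litLr-restrict L Γ j legalBefore) (illegal ∘ litLr-restrict⁻¹ L Γ (suc j))
      (litLr-restrict L Υ (suc j') legalΥ)

  cirqIllegalityPersists : ∀ C → IllegalityPersists (cirqGame I C)
  cirqIllegalityPersists C ℘ Γ Υ delay@(same , _) {j} {j'} Γj Υj' count legalBefore illegalAt legalΥ =
    illegalAt (labelsAt ,
               (λ L → litLegalAt ℘ Γ Υ delay Γj Υj' count L (lits legalBefore L) (lits legalΥ L)) ,
               ChosenOnce-extend (≈-sym (same bot)) Γj Υj' count (once⊓ legalBefore) (once⊓ legalΥ) ,
               ChosenOnce-extend (≈-sym (same top)) Γj Υj' count (once⊔ legalBefore) (once⊔ legalΥ))
    where
    labelsAt : WellLabelled (restrict Γ (suc j))
    labelsAt n p m e with restrict-suc-just Γ e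
    ... | Γn , inj₁ n<j  = labels legalBefore n p m (trans (restrict-< Γ n<j) Γn)
    ... | Γn , inj₂ refl = labels legalΥ j' p m (trans (restrict-< Υ ≤-refl) (trans Υj' (trans (sym Γj) Γn)))

  module _ {Γ Υ} (delay : Delay top Υ Γ) (legalΓ : LrC I Γ) (legalΥ : LrC I Υ) where

    topWinsC-delay : ∀ C → TopWinsC I C Γ → TopWinsC I C Υ

    wonBy-delay : ∀ C → WonBy top (cirqGame I C) Γ → WonBy top (cirqGame I C) Υ
    wonBy-delay C (inj₁ (_ , wins))  = inj₁ (legalΥ , topWinsC-delay C wins)
    wonBy-delay C (inj₂ ¬legalFor) = contradiction (inj₁ legalΓ) ¬legalFor

    topWinsC-delay ⊤c        wins = wins
    topWinsC-delay ⊥c        ()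
    topWinsC-delay (lit L)   wins =
      static⇒topWinsDelayClosed (litStatic L) (proj L Γ) (proj L Υ) (Delay-proj L delay)
        (lits legalΓ L) (lits legalΥ L) wins
    topWinsC-delay (A ∨c B)  wins = Sum.map (wonBy-delay A) (wonBy-delay B) wins
    topWinsC-delay (A ∧c B)  wins = Product.map (wonBy-delay A) (wonBy-delay B) wins
    topWinsC-delay (⊓c c A B) wins i n Υn with correspondingMove Υ Γ (proj₁ delay bot) Υn
    ... | n' , Γn' , _ = selSet-map i (wonBy-delay A) (wonBy-delay B) (wins i n' Γn')
    topWinsC-delay (⊔c c A B) (i , n , Γn , wins) with correspondingMove Γ Υ (≈-sym (proj₁ delay top)) Γn
    ... | n' , Υn' , _ = i , n' , Υn' , selSet-map i (wonBy-delay A) (wonBy-delay B) wins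

  cirqStatic : ∀ C → Static (cirqGame I C)
  cirqStatic C = static-from em (cirqLrAxioms C) (cirqIllegalityPersists C)
                   (λ Γ Υ delay legalΓ legalΥ → topWinsC-delay delay legalΓ legalΥ C)

fact4p2 : ExcludedMiddle 0ℓ → (C : Cirq) (I : Interp) →
            (∀ P → IsGame (I P)) → (∀ P → Static (I P)) → Static (cirqGame I C)
fact4p2 em C I isGame static = CirquentGame.cirqStatic em I litAxioms litStatic C
  where
  litAxioms : ∀ L → LrAxioms (litGame I L)
  litAxioms (pos P _) = IsGame⇒LrAxioms (isGame P)
  litAxioms (neg P _) = LrAxioms-negG (IsGame⇒LrAxioms (isGame P))
  litStatic : ∀ L → Static (litGame I L)
  litStatic (pos P _) = static P
  litStatic (neg P _) = Static-negG (IsGame⇒LrAxioms (isGame P)) em (static P)
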